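{- Let $m\ge 2$ and $\ell\ge 3$ be integers. The graph $W(m,\ell)$ is bipartite and not $3$-connected. Moreover, $W(m,\ell)$ is distance-balanced if and only if $\ell$ is odd.
   Context: For $0\le i\le 4\ell-1$ let $f(i)=1$ if $i\equiv 0$ or $3 \pmod 4$, and $f(i)=m$ otherwise. $W(m,\ell)$ is the graph with vertex set $\{(i,j): 0\le i\le 4\ell-1,\ 1\le j\le f(i)\}$ in which $(i_1,j_1)$ and $(i_2,j_2)$ are adjacent iff $i_2-i_1\equiv \pm1 \pmod{4\ell}$ (i.e. the cycle of length $4\ell$ with every second pair of consecutive vertices replaced by a complete bipartite graph $K_{m,m}$). For $u,v$ let $W_{uv}=\{z: d(u,z)<d(v,z)\}$; a connected graph is distance-balanced if $|W_{uv}|=|W_{vu}|$ for all adjacent $u,v$. A graph is $3$-connected if it has at least $4$ vertices and removing any at most $2$ vertices leaves it connected. -}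

module Defs where

open import Data.Nat using (ℕ; zero; suc; _+_; _*_; _≤_; _<_)
open import Data.Nat.DivMod using (_%_)
open import Data.Fin using (Fin; toℕ)
open import Data.Bool using (Bool)
open import Data.List using (List; []; length)
open import Data.List.Membership.Propositional using (_∈_; _∉_)
open import Data.List.Relation.Unary.Unique.Propositional using (Unique)
open import Data.Product using (Σ; ∃; ∃₂; _×_)
open import Data.Sum using (_⊎_)
open import Relation.Binary.PropositionalEquality using (_≡_; _≢_)
open import Relation.Nullary using (¬_)
open import Function.Bundles using (_⇔_)

record Graph : Set₁ where
  field
    V   : Set
    _~_ : V → V → Set

module _ (G : Graph) where
  open Graph G

  data WalkAvoid (S : List V) : V → V → ℕ → Set where
    here : ∀ {u} → u ∉ S → WalkAvoid S u u 0
    step : ∀ {u w v k} → u ∉ S → u ~ w → WalkAvoid S w v k → WalkAvoid S u v (suc k)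

  Walk : V → V → ℕ → Set
  Walk = WalkAvoid []

  Connected : Set
  Connected = ∀ u v → ∃ λ k → Walk u v k

  Dist : V → V → ℕ → Set
  Dist u v k = Walk u v k × (∀ k' → k' < k → ¬ Walk u v k')

  InW : V → V → V → Set
  InW u v z = ∃₂ λ a b → Dist u z a × Dist v z b × a < b

  HasSize : (V → Set) → ℕ → Set
  HasSize P n = Σ (List V) λ xs → Unique xs × (∀ z → z ∈ xs ⇔ P z) × length xs ≡ n

  DistanceBalanced : Set
  DistanceBalanced = Connected ×
    (∀ u v → u ~ v → ∃ λ n → HasSize (InW u v) n × HasSize (InW v u) n)

  Bipartite : Set
  Bipartite = Σ (V → Bool) λ c → ∀ u v → u ~ v → c u ≢ c v

  ThreeConnected : Set
  ThreeConnected =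
    (Σ (List V) λ xs → Unique xs × 4 ≤ length xs) ×
    (∀ (S : List V) → length S ≤ 2 → ∀ u v → u ∉ S → v ∉ S → ∃ λ k → WalkAvoid S u v k)

fW : ℕ → ℕ → ℕ
fW m i with i % 4
... | 0 = 1
... | 3 = 1
... | _ = m

-- b ≡ a + 1 (mod 4ℓ), for a, b ∈ {0, …, 4ℓ-1}
NextMod : ℕ → ℕ → ℕ → Set
NextMod ℓ a b = (suc a ≡ b) ⊎ (suc a ≡ 4 * ℓ × b ≡ 0)

W : ℕ → ℕ → Graph
W m ℓ = record
  { V   = Σ (Fin (4 * ℓ)) (λ i → Fin (fW m (toℕ i)))
  ; _~_ = λ x y → NextMod ℓ (toℕ (Σ.proj₁ x)) (toℕ (Σ.proj₁ y))
                ⊎ NextMod ℓ (toℕ (Σ.proj₁ y)) (toℕ (Σ.proj₁ x))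
  }

module Submission where

-- W(m,ℓ) consists of n = 4ℓ layers L_0, …, L_{n-1} arranged in a cycle; layer i has
-- f(i) vertices and consecutive layers are completely joined.
--
-- * Bipartite: colour a vertex by the parity of its layer; n is even.
-- * Not 3-connected: layers 0 and 3 have one vertex each, and removing these two
--   vertices cuts the layers 1, 2 off from layer 4.
-- * Distances: with off(a,b) the forward offset from layer a to layer b and
--   cdist r = min(r, n-r), two vertices in different layers are at distance
--   cdist(off), and distinct vertices of one layer are at distance 2.  The lower bound
--   holds because one step changes the offset by one (cdist is 1-Lipschitz).
-- * Edge sizes: for an edge from layer i to layer i+1 and n = 2 + t + t, a vertex r
--   layers after i is closer to v for 2 ≤ r ≤ 2ℓ and closer to u for r > 2ℓ, so
--   |W_uv| = f(i+1) + Σ_{j<t} f(i+2+t+j) and |W_vu| = f(i) + Σ_{j<t} f(i+2+j),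
--   counted by listing the vertices layer by layer starting at layer i.
-- * Arithmetic: f has period 4 and f(x) + f(x+2) = m+1.  For ℓ odd (t ≡ 1 mod 4) both
--   side sizes (sideU, sideV) equal k·2(m+1) + (m+1); for ℓ even (t ≡ 3 mod 4) the edge from layer 0 to
--   layer 1 has sides of sizes c + 3m + 1 and c + m + 3, which differ when m ≥ 2.

open import Defs
open import Data.Nat using (ℕ; _≤_)
open import Data.Nat.DivMod using (_%_)
open import Data.Product using (_×_)
open import Relation.Binary.PropositionalEquality using (_≡_)
open import Relation.Nullary using (¬_)
open import Function.Bundles using (_⇔_)

open import Data.Nat
open import Data.Nat.Properties
open import Data.Nat.DivMod
open import Data.Nat.Divisibility using (_∣_; m∣m*n)
open import Data.Nat.Tactic.RingSolver using (solve-∀)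
open import Algebra.Properties.CommutativeSemigroup +-commutativeSemigroup using (x∙yz≈y∙xz)
open import Data.Bool using (Bool; true; not)
open import Data.Bool.Properties using (not-¬; not-involutive)
open import Data.Fin as Fin using (Fin; toℕ; fromℕ<)
open import Data.Fin.Properties using (toℕ-fromℕ<; toℕ-injective; toℕ<n)
open import Data.Product using (∃; _,_; proj₁; proj₂)
open import Data.Product.Properties using (≡-dec)
open import Data.Sum using (_⊎_; inj₁; inj₂)
open import Data.List using (List; []; _∷_; length; filter; map; allFin; _++_)
open import Data.List.Properties using (filter-all; filter-none; filter-++; length-++; length-map; length-tabulate)
open import Data.List.Relation.Unary.Any using (here; there)
import Data.List.Relation.Unary.All as All
open import Data.List.Relation.Unary.AllPairs.Core using ([]; _∷_)
open import Data.List.Relation.Unary.Unique.Propositional using (Unique)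
import Data.List.Relation.Unary.Unique.Propositional.Properties as Unique
open import Data.List.Membership.Propositional using (_∈_; _∉_)
open import Data.List.Membership.Propositional.Properties
  using (∈-map⁺; ∈-map⁻; ∈-allFin; ∈-++⁻; ∈-++⁺ˡ; ∈-++⁺ʳ; ∈-filter⁺; ∈-filter⁻)
open import Data.List.Membership.Propositional.Properties.WithK using (unique∧set⇒bag)
open import Data.List.Relation.Binary.BagAndSetEquality using (∼bag⇒↭)
open import Data.List.Relation.Binary.Permutation.Propositional.Properties using (↭-length)
open import Relation.Binary.PropositionalEquality
open import Relation.Binary.Definitions using (tri<; tri≈; tri>)
open import Relation.Nullary using (Dec; yes; no; contradiction)
open import Relation.Unary using (Decidable)
open import Function.Base using (_∘′_)
open import Function.Bundles using (mk⇔; Equivalence)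
open Equivalence using (to; from)

sizeOfResidue : ℕ → ℕ → ℕ
sizeOfResidue m 0 = 1
sizeOfResidue m 3 = 1
sizeOfResidue m _ = m

fW-residue : ∀ m x → fW m x ≡ sizeOfResidue m (x % 4)
fW-residue m x with x % 4
... | 0 = refl
... | 1 = refl
... | 2 = refl
... | 3 = refl
... | suc (suc (suc (suc _))) = refl

fW-cong : ∀ m x y → x % 4 ≡ y % 4 → fW m x ≡ fW m y
fW-cong m x y e = trans (fW-residue m x) (trans (cong (sizeOfResidue m) e) (sym (fW-residue m y)))

fW-periodic : ∀ m x q → fW m (x + q * 4) ≡ fW m x
fW-periodic m x q = fW-cong m (x + q * 4) x ([m+kn]%n≡m%n x q 4)

fW-shift4 : ∀ m x → fW m (4 + x) ≡ fW m x
fW-shift4 m x = trans (cong (fW m) (+-comm 4 x)) (fW-periodic m x 1)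

fW-mod : ∀ m x d .{{_ : NonZero d}} → 4 ∣ d → fW m (x % d) ≡ fW m x
fW-mod m x d 4∣d = fW-cong m (x % d) x (m∣n⇒o%n%m≡o%m 4 d x 4∣d)

-- Two layers at distance 2 are one thin layer and one thick layer.
fW-pair : ∀ m x → fW m x + fW m (2 + x) ≡ suc m
fW-pair m 0 = refl
fW-pair m 1 = +-comm m 1
fW-pair m 2 = +-comm m 1
fW-pair m 3 = refl
fW-pair m (suc (suc (suc (suc x)))) =
  trans (cong₂ _+_ (fW-shift4 m x) (fW-shift4 m (2 + x))) (fW-pair m x)

fW-positive : ∀ {m} → 1 ≤ m → ∀ x → 0 < fW m x
fW-positive {m} m≥1 x = subst (0 <_) (sym (fW-residue m x)) (residue (x % 4))
  where
  residue : ∀ k → 0 < sizeOfResidue m k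
  residue 0 = s≤s z≤n
  residue 1 = m≥1
  residue 2 = m≥1
  residue 3 = s≤s z≤n
  residue (suc (suc (suc (suc _)))) = m≥1

sum< : ℕ → (ℕ → ℕ) → ℕ
sum< zero    f = 0
sum< (suc k) f = sum< k f + f k

sum<-cong : ∀ k {f g : ℕ → ℕ} → (∀ j → j < k → f j ≡ g j) → sum< k f ≡ sum< k g
sum<-cong zero    eq = refl
sum<-cong (suc k) eq = cong₂ _+_ (sum<-cong k (λ j j<k → eq j (m<n⇒m<1+n j<k))) (eq k ≤-refl)

sum<-zero : ∀ k {f : ℕ → ℕ} → (∀ j → j < k → f j ≡ 0) → sum< k f ≡ 0
sum<-zero zero    eq = refl
sum<-zero (suc k) eq = cong₂ _+_ (sum<-zero k (λ j j<k → eq j (m<n⇒m<1+n j<k))) (eq k ≤-refl)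

sum<-split : ∀ a b f → sum< (a + b) f ≡ sum< a f + sum< b (λ j → f (a + j))
sum<-split a zero    f = trans (cong (λ k → sum< k f) (+-identityʳ a)) (sym (+-identityʳ _))
sum<-split a (suc b) f = begin
  sum< (a + suc b) f                                    ≡⟨ cong (λ k → sum< k f) (+-suc a b) ⟩
  sum< (a + b) f + f (a + b)                            ≡⟨ cong (_+ f (a + b)) (sum<-split a b f) ⟩
  sum< a f + sum< b (λ j → f (a + j)) + f (a + b)       ≡⟨ +-assoc (sum< a f) _ _ ⟩
  sum< a f + (sum< b (λ j → f (a + j)) + f (a + b))     ∎
  where open ≡-Reasoning

block : ℕ → ℕ → ℕ → ℕ
block m x t = sum< t (λ j → fW m (x + j))

block-4 : ∀ m x → block m x 4 ≡ suc m + suc m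
block-4 m x = begin
  0 + a + b + c + d    ≡⟨ regroup a b c d ⟩
  (a + c) + (b + d)    ≡⟨ cong₂ _+_ (trans (cong₂ fsum (+-identityʳ x) (+-comm x 2)) (fW-pair m x))
                                    (trans (cong₂ fsum (+-comm x 1) (+-comm x 3)) (fW-pair m (1 + x))) ⟩
  suc m + suc m        ∎
  where
  open ≡-Reasoning
  a = fW m (x + 0)
  b = fW m (x + 1)
  c = fW m (x + 2)
  d = fW m (x + 3)
  fsum : ℕ → ℕ → ℕ
  fsum p q = fW m p + fW m q
  regroup : ∀ a b c d → 0 + a + b + c + d ≡ (a + c) + (b + d)
  regroup = solve-∀

block-periodic : ∀ m x q s → block m x (q * 4 + s) ≡ q * (suc m + suc m) + block m x s
block-periodic m x zero    s = refl
block-periodic m x (suc q) s = begin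
  block m x (4 + (q * 4 + s))                                  ≡⟨ sum<-split 4 (q * 4 + s) _ ⟩
  block m x 4 + sum< (q * 4 + s) (λ j → fW m (x + (4 + j)))    ≡⟨ cong₂ _+_ (block-4 m x)
                                                                   (sum<-cong (q * 4 + s) (λ j _ → shift j)) ⟩
  suc m + suc m + block m x (q * 4 + s)                        ≡⟨ cong (suc m + suc m +_) (block-periodic m x q s) ⟩
  suc m + suc m + (q * (suc m + suc m) + block m x s)          ≡⟨ sym (+-assoc (suc m + suc m) _ _) ⟩
  suc q * (suc m + suc m) + block m x s                        ∎
  where
  open ≡-Reasoning
  shift : ∀ j → fW m (x + (4 + j)) ≡ fW m (x + j)
  shift j = trans (cong (fW m) (trans (+-comm x (4 + j)) (cong (4 +_) (+-comm j x)))) (fW-shift4 m (x + j))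

block-shift : ∀ m x q s → block m (x + q * 4) s ≡ block m x s
block-shift m x q s = sum<-cong s (λ j _ → trans (cong (fW m) (swap x (q * 4) j)) (fW-periodic m (x + j) q))
  where
  swap : ∀ a b c → a + b + c ≡ a + c + b
  swap = solve-∀

-- The sizes of the two sides W_uv and W_vu of an edge uv from layer i to layer i+1,
-- where t is the number of layers strictly between layer i+1 and the layer antipodal to i.
sideU : ℕ → ℕ → ℕ → ℕ
sideU m i t = fW m (suc i) + block m (i + (2 + t)) t

sideV : ℕ → ℕ → ℕ → ℕ
sideV m i t = fW m i + block m (i + 2) t

balanced-odd : ∀ m i k → sideU m i (k * 4 + 1) ≡ sideV m i (k * 4 + 1)
balanced-odd m i k = trans (side (suc i) (i + (2 + (k * 4 + 1))) (trans (cong (fW m) (far i k)) (fW-periodic m (3 + i) k)))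
                           (sym (side i (i + 2) (cong (fW m) (near i))))
  where
  far : ∀ i k → i + (2 + (k * 4 + 1)) + 0 ≡ 3 + i + k * 4
  far = solve-∀
  near : ∀ i → i + 2 + 0 ≡ 2 + i
  near = solve-∀
  side : ∀ a x → fW m (x + 0) ≡ fW m (2 + a) → fW m a + block m x (k * 4 + 1) ≡ k * (suc m + suc m) + suc m
  side a x e = begin
    fW m a + block m x (k * 4 + 1)                     ≡⟨ cong (fW m a +_) (block-periodic m x k 1) ⟩
    fW m a + (k * (suc m + suc m) + fW m (x + 0))      ≡⟨ cong (λ y → fW m a + (k * (suc m + suc m) + y)) e ⟩
    fW m a + (k * (suc m + suc m) + fW m (2 + a))      ≡⟨ x∙yz≈y∙xz (fW m a) (k * (suc m + suc m)) (fW m (2 + a)) ⟩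
    k * (suc m + suc m) + (fW m a + fW m (2 + a))      ≡⟨ cong (k * (suc m + suc m) +_) (fW-pair m a) ⟩
    k * (suc m + suc m) + suc m                        ∎
    where open ≡-Reasoning

-- For t ≡ 3 (mod 4) and m ≥ 2 the edge from layer 0 to layer 1 is unbalanced:
-- the sides have sizes c + 3m + 1 and c + m + 3 for c = k·2(m+1).
unbalanced-even : ∀ m k → 2 ≤ m → sideU m 0 (k * 4 + 3) ≢ sideV m 0 (k * 4 + 3)
unbalanced-even m k m≥2 eq = contradiction (subst (4 ≤_) m+m≡2 (+-mono-≤ m≥2 m≥2)) λ { (s≤s (s≤s ())) }
  where
  c = k * (suc m + suc m)
  left : fW m 1 + block m (2 + (k * 4 + 3)) (k * 4 + 3) ≡ m + (c + (m + m + 1))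
  left = cong (m +_) (trans (block-periodic m (2 + (k * 4 + 3)) k 3)
                            (cong (c +_) (trans (cong (λ x → block m x 3) (start k)) (block-shift m 5 k 3))))
    where
    start : ∀ k → 2 + (k * 4 + 3) ≡ 5 + k * 4
    start = solve-∀
  right : fW m 0 + block m 2 (k * 4 + 3) ≡ 1 + (c + (m + 1 + 1))
  right = cong (1 +_) (block-periodic m 2 k 3)
  regroupˡ : ∀ m c → m + (c + (m + m + 1)) ≡ (m + m) + (c + (m + 1))
  regroupˡ = solve-∀
  regroupʳ : ∀ m c → 1 + (c + (m + 1 + 1)) ≡ 2 + (c + (m + 1))
  regroupʳ = solve-∀
  m+m≡2 : m + m ≡ 2
  m+m≡2 = +-cancelʳ-≡ (c + (m + 1)) (m + m) 2
            (trans (sym (regroupˡ m c)) (trans (sym left) (trans eq (trans right (regroupʳ m c)))))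

-- Arithmetic on a cycle of length n, with positions represented by 0, …, n-1.
module Cycle (n : ℕ) .{{_ : NonZero n}} where

  %-absorbˡ : ∀ x y → (x % n + y) % n ≡ (x + y) % n
  %-absorbˡ x y = begin
    (x % n + y) % n           ≡⟨ %-distribˡ-+ (x % n) y n ⟩
    (x % n % n + y % n) % n   ≡⟨ cong (λ z → (z + y % n) % n) (m%n%n≡m%n x n) ⟩
    (x % n + y % n) % n       ≡⟨ sym (%-distribˡ-+ x y n) ⟩
    (x + y) % n               ∎
    where open ≡-Reasoning

  %-absorbʳ : ∀ x y → (x + y % n) % n ≡ (x + y) % n
  %-absorbʳ x y = trans (cong (_% n) (+-comm x (y % n)))
                    (trans (%-absorbˡ y x) (cong (_% n) (+-comm y x)))

  off : ℕ → ℕ → ℕ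
  off a b = (b + (n ∸ a)) % n

  off<n : ∀ a b → off a b < n
  off<n a b = m%n<n (b + (n ∸ a)) n

  off-char : ∀ {a b x} → a < n → x < n → (a + x) % n ≡ b → off a b ≡ x
  off-char {a} {b} {x} a<n x<n refl = begin
    ((a + x) % n + (n ∸ a)) % n   ≡⟨ %-absorbˡ (a + x) (n ∸ a) ⟩
    (a + x + (n ∸ a)) % n         ≡⟨ cong (_% n) (trans (+-assoc a x (n ∸ a)) (x∙yz≈y∙xz a x (n ∸ a))) ⟩
    (x + (a + (n ∸ a))) % n       ≡⟨ cong (λ y → (x + y) % n) (m+[n∸m]≡n (<⇒≤ a<n)) ⟩
    (x + n) % n                   ≡⟨ [m+n]%n≡m%n x n ⟩
    x % n                         ≡⟨ m<n⇒m%n≡m x<n ⟩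
    x                             ∎
    where open ≡-Reasoning

  off-spec : ∀ {a b} → a < n → b < n → (a + off a b) % n ≡ b
  off-spec {a} {b} a<n b<n = begin
    (a + (b + (n ∸ a)) % n) % n   ≡⟨ %-absorbʳ a (b + (n ∸ a)) ⟩
    (a + (b + (n ∸ a))) % n       ≡⟨ cong (_% n) (x∙yz≈y∙xz a b (n ∸ a)) ⟩
    (b + (a + (n ∸ a))) % n       ≡⟨ cong (λ y → (b + y) % n) (m+[n∸m]≡n (<⇒≤ a<n)) ⟩
    (b + n) % n                   ≡⟨ [m+n]%n≡m%n b n ⟩
    b % n                         ≡⟨ m<n⇒m%n≡m b<n ⟩
    b                             ∎
    where open ≡-Reasoning

  off-self : ∀ {a} → a < n → off a a ≡ 0
  off-self {a} a<n = off-char a<n (>-nonZero⁻¹ n) (trans (cong (_% n) (+-identityʳ a)) (m<n⇒m%n≡m a<n))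

  off-zero : ∀ {a b} → a < n → b < n → off a b ≡ 0 → a ≡ b
  off-zero {a} {b} a<n b<n e = begin
    a                     ≡⟨ sym (m<n⇒m%n≡m a<n) ⟩
    a % n                 ≡⟨ cong (_% n) (sym (+-identityʳ a)) ⟩
    (a + 0) % n           ≡⟨ cong (λ x → (a + x) % n) (sym e) ⟩
    (a + off a b) % n     ≡⟨ off-spec a<n b<n ⟩
    b                     ∎
    where open ≡-Reasoning

  off-flip : ∀ {a b} → a < n → b < n → a ≢ b → off b a ≡ n ∸ off a b
  off-flip {a} {b} a<n b<n a≢b = off-char b<n (∸-monoʳ-< 0<r (<⇒≤ (off<n a b))) (begin
    (b + (n ∸ r)) % n                 ≡⟨ cong (λ y → (y + (n ∸ r)) % n) (sym (off-spec a<n b<n)) ⟩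
    ((a + r) % n + (n ∸ r)) % n       ≡⟨ %-absorbˡ (a + r) (n ∸ r) ⟩
    (a + r + (n ∸ r)) % n             ≡⟨ cong (_% n) (trans (+-assoc a r _) (cong (a +_) (m+[n∸m]≡n (<⇒≤ (off<n a b))))) ⟩
    (a + n) % n                       ≡⟨ [m+n]%n≡m%n a n ⟩
    a % n                             ≡⟨ m<n⇒m%n≡m a<n ⟩
    a                                 ∎)
    where
    open ≡-Reasoning
    r = off a b
    0<r : 0 < r
    0<r = n≢0⇒n>0 (λ r≡0 → a≢b (off-zero a<n b<n r≡0))

  off-next : ∀ {a b} → a < n → b < n → off a b ≡ suc (off (suc a % n) b) % n
  off-next {a} {b} a<n b<n = off-char a<n (m%n<n (suc r′) n) (begin
    (a + suc r′ % n) % n     ≡⟨ %-absorbʳ a (suc r′) ⟩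
    (a + suc r′) % n         ≡⟨ cong (_% n) (+-suc a r′) ⟩
    (suc a + r′) % n         ≡⟨ sym (%-absorbˡ (suc a) r′) ⟩
    (suc a % n + r′) % n     ≡⟨ off-spec (m%n<n (suc a) n) b<n ⟩
    b                        ∎)
    where
    open ≡-Reasoning
    r′ = off (suc a % n) b

  next-suc : ∀ {x k} → x < n → suc x % n ≡ suc k → x ≡ k
  next-suc {x} x<n e with suc x <? n
  ... | yes sx<n = suc-injective (trans (sym (m<n⇒m%n≡m sx<n)) e)
  ... | no sx≮n  = contradiction (trans (sym wraps) e) λ ()
    where
    wraps : suc x % n ≡ 0
    wraps = trans (cong (_% n) (≤-antisym x<n (≮⇒≥ sx≮n))) (n%n≡0 n)

  off-pred : ∀ {a b k} → a < n → b < n → off a b ≡ suc k → off (suc a % n) b ≡ k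
  off-pred {a} {b} a<n b<n e = next-suc (off<n (suc a % n) b) (trans (sym (off-next a<n b<n)) e)

  cdist : ℕ → ℕ
  cdist r = r ⊓ (n ∸ r)

  cdist-next : ∀ {r} → r < n → cdist (suc r % n) ≤ suc (cdist r) × cdist r ≤ suc (cdist (suc r % n))
  cdist-next {r} r<n with suc r <? n
  ... | yes sr<n rewrite m<n⇒m%n≡m sr<n =
        ≤-trans (⊓-mono-≤ (≤-refl {suc r}) (n≤1+n s))
                (s≤s (⊓-mono-≤ (≤-refl {r}) (≤-trans (n≤1+n s) (≤-reflexive (sym e)))))
      , ≤-trans (⊓-mono-≤ (n≤1+n r) (≤-reflexive e)) (s≤s (⊓-mono-≤ (n≤1+n r) (≤-refl {s})))
    where
    s = n ∸ suc r
    e : n ∸ r ≡ suc s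
    e = +-∸-assoc 1 r<n
  ... | no sr≮n = subst (λ x → cdist x ≤ suc (cdist r) × cdist r ≤ suc (cdist x)) (sym wrap)
                     (z≤n , ≤-trans (m⊓n≤n r (n ∸ r)) (≤-reflexive one))
    where
    sr≡n : suc r ≡ n
    sr≡n = ≤-antisym r<n (≮⇒≥ sr≮n)
    wrap : suc r % n ≡ 0
    wrap = trans (cong (_% n) sr≡n) (n%n≡0 n)
    one : n ∸ r ≡ 1
    one = trans (cong (_∸ r) (sym sr≡n)) (trans (+-∸-assoc 1 (≤-refl {r})) (cong suc (n∸n≡0 r)))

  cdist-small : ∀ {r} → r + r ≤ n → cdist r ≡ r
  cdist-small {r} le = m≤n⇒m⊓n≡m (subst (_≤ n ∸ r) (m+n∸m≡n r r) (∸-monoˡ-≤ r le))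

  cdist-large : ∀ {r} → n ≤ r + r → cdist r ≡ n ∸ r
  cdist-large {r} le = m≥n⇒m⊓n≡n (≤-trans (∸-monoˡ-≤ r le) (≤-reflexive (m+n∸m≡n r r)))


⇔-both : ∀ {P Q : Set} → P → Q → P ⇔ Q
⇔-both p q = mk⇔ (λ _ → q) (λ _ → p)

⇔-neither : ∀ {P Q : Set} → ¬ P → ¬ Q → P ⇔ Q
⇔-neither ¬p ¬q = mk⇔ (λ p → contradiction p ¬p) (λ q → contradiction q ¬q)

module _ {A : Set} {P : A → Set} (P? : Decidable P) where

  count-only : ∀ {u} xs → Unique xs → u ∈ xs → (∀ z → z ∈ xs → P z ⇔ z ≡ u) →
               length (filter P? xs) ≡ 1
  count-only (x ∷ xs) (x∉xs ∷ uxs) u∈ hyp with P? x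
  ... | yes px = cong suc (cong length (filter-none P? (All.tabulate λ {z} z∈xs pz →
                   All.lookup x∉xs z∈xs (trans (to (hyp x (here refl)) px) (sym (to (hyp z (there z∈xs)) pz))))))
  ... | no ¬px with u∈
  ...   | here refl = contradiction (from (hyp x (here refl)) refl) ¬px
  ...   | there u∈xs = count-only xs uxs u∈xs (λ z z∈xs → hyp z (there z∈xs))

  count-allBut : ∀ {u} xs → Unique xs → u ∈ xs → (∀ z → z ∈ xs → P z ⇔ z ≢ u) →
                 suc (length (filter P? xs)) ≡ length xs
  count-allBut (x ∷ xs) (x∉xs ∷ uxs) u∈ hyp with P? x | u∈
  ... | yes px | here u≡x = contradiction (sym u≡x) (to (hyp x (here refl)) px)
  ... | yes px | there u∈xs = cong suc (count-allBut xs uxs u∈xs (λ z z∈xs → hyp z (there z∈xs)))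
  ... | no ¬px | here u≡x = cong suc (cong length (filter-all P? (All.tabulate λ {z} z∈xs →
                   from (hyp z (there z∈xs)) (λ z≡u → All.lookup x∉xs z∈xs (sym (trans z≡u u≡x))))))
  ... | no ¬px | there u∈xs = contradiction (from (hyp x (here refl)) (All.lookup x∉xs u∈xs)) ¬px

module _ (G : Graph) where
  open Graph G

  Dist-unique : ∀ {u z a b} → Dist G u z a → Dist G u z b → a ≡ b
  Dist-unique {a = a} {b} (walk-a , no-shorter-a) (walk-b , no-shorter-b) with <-cmp a b
  ... | tri< a<b _ _ = contradiction walk-a (no-shorter-b a a<b)
  ... | tri≈ _ a≡b _ = a≡b
  ... | tri> _ _ b<a = contradiction walk-b (no-shorter-a b b<a)

  HasSize-unique : ∀ {P a b} → HasSize G P a → HasSize G P b → a ≡ b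
  HasSize-unique (xs , uxs , xs⇔P , refl) (ys , uys , ys⇔P , refl) =
    ↭-length (∼bag⇒↭ (unique∧set⇒bag uxs uys same-members))
    where
    same-members : ∀ {z} → (z ∈ xs) ⇔ (z ∈ ys)
    same-members {z} = mk⇔ (from (ys⇔P z) ∘′ to (xs⇔P z)) (from (xs⇔P z) ∘′ to (ys⇔P z))

  HasSize-⇔ : ∀ {P Q k} → (∀ z → P z ⇔ Q z) → HasSize G P k → HasSize G Q k
  HasSize-⇔ P⇔Q (xs , uxs , xs⇔P , len) =
    xs , uxs , (λ z → mk⇔ (to (P⇔Q z) ∘′ to (xs⇔P z)) (from (xs⇔P z) ∘′ from (P⇔Q z))) , len

  module SymmetricWalks (~-sym : ∀ {u v} → u ~ v → v ~ u) where

    snoc : ∀ {u w z k} → Walk G u w k → w ~ z → Walk G u z (suc k)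
    snoc (here _)        w~z = step (λ ()) w~z (here (λ ()))
    snoc (step _ u~x wk) w~z = step (λ ()) u~x (snoc wk w~z)

    reverse : ∀ {u z k} → Walk G u z k → Walk G z u k
    reverse (here _)        = here (λ ())
    reverse (step _ u~w wk) = snoc (reverse wk) (~-sym u~w)

-- Colouring the layers alternately shows that W(m,ℓ) is bipartite: n = 4ℓ is even.
isEven : ℕ → Bool
isEven zero    = true
isEven (suc k) = not (isEven k)

isEven-double : ∀ x → isEven (x + x) ≡ true
isEven-double zero    = refl
isEven-double (suc x) = begin
  not (isEven (x + suc x))       ≡⟨ cong (λ y → not (isEven y)) (+-suc x x) ⟩
  not (not (isEven (x + x)))     ≡⟨ not-involutive _ ⟩
  isEven (x + x)                 ≡⟨ isEven-double x ⟩
  true                           ∎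
  where open ≡-Reasoning

nextMod-flips : ∀ {ℓ a b} → NextMod ℓ a b → isEven a ≢ isEven b
nextMod-flips (inj₁ refl) = not-¬ refl
nextMod-flips {ℓ} {a} (inj₂ (sa≡n , refl)) pa≡true = contradiction (trans (sym (cong not pa≡true)) wraps) λ ()
  where
  wraps : not (isEven a) ≡ true
  wraps = trans (cong isEven sa≡n) (trans (cong isEven (*-distribʳ-+ ℓ 2 2)) (isEven-double (2 * ℓ)))

W-bipartite : ∀ m ℓ → Bipartite (W m ℓ)
W-bipartite m ℓ = (λ u → isEven (toℕ (proj₁ u))) , adjacent
  where
  adjacent : ∀ u v → Graph._~_ (W m ℓ) u v → isEven (toℕ (proj₁ u)) ≢ isEven (toℕ (proj₁ v))
  adjacent u v (inj₁ uv) = nextMod-flips {ℓ} uv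
  adjacent u v (inj₂ vu) = λ e → nextMod-flips {ℓ} vu (sym e)

module Layered (m ℓ : ℕ) (m≥1 : 1 ≤ m) (ℓ≥1 : 1 ≤ ℓ) where

  n : ℕ
  n = 4 * ℓ

  n≥4 : 4 ≤ n
  n≥4 = *-monoʳ-≤ 4 ℓ≥1

  instance
    n-nonZero : NonZero n
    n-nonZero = >-nonZero (≤-trans (s≤s z≤n) n≥4)

  open Cycle n public
  open Graph (W m ℓ) public using (V; _~_)

  lay : V → ℕ
  lay u = toℕ (proj₁ u)

  lay<n : ∀ u → lay u < n
  lay<n u = toℕ<n (proj₁ u)

  vertexAt : (a : ℕ) → a < n → V
  vertexAt a a<n = fromℕ< a<n , fromℕ< (fW-positive m≥1 (toℕ (fromℕ< a<n)))

  lay-vertexAt : ∀ {a} (a<n : a < n) → lay (vertexAt a a<n) ≡ a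
  lay-vertexAt a<n = toℕ-fromℕ< a<n

  _≟V_ : (u z : V) → Dec (u ≡ z)
  _≟V_ = ≡-dec Fin._≟_ Fin._≟_

  nextMod⇒ : ∀ {a b} → b < n → NextMod ℓ a b → suc a % n ≡ b
  nextMod⇒ b<n (inj₁ refl)            = m<n⇒m%n≡m b<n
  nextMod⇒ b<n (inj₂ (sa≡n , refl))   = trans (cong (_% n) sa≡n) (n%n≡0 n)

  ⇒nextMod : ∀ {a} → a < n → NextMod ℓ a (suc a % n)
  ⇒nextMod {a} a<n with suc a <? n
  ... | yes sa<n = inj₁ (sym (m<n⇒m%n≡m sa<n))
  ... | no sa≮n  = inj₂ (sa≡n , trans (cong (_% n) sa≡n) (n%n≡0 n))
    where
    sa≡n : suc a ≡ n
    sa≡n = ≤-antisym a<n (≮⇒≥ sa≮n)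

  ~-layers : ∀ {u v u′ v′} → lay u ≡ lay u′ → lay v ≡ lay v′ → u ~ v → u′ ~ v′
  ~-layers eu ev = subst₂ (λ a b → NextMod ℓ a b ⊎ NextMod ℓ b a) eu ev

  ~-sym : ∀ {u v} → u ~ v → v ~ u
  ~-sym (inj₁ uv) = inj₂ uv
  ~-sym (inj₂ vu) = inj₁ vu

  ~-forward : ∀ {u v} → suc (lay u) % n ≡ lay v → u ~ v
  ~-forward {u} e = inj₁ (subst (NextMod ℓ (lay u)) e (⇒nextMod (lay<n u)))

  nextMod-irrefl : ∀ {a} → ¬ NextMod ℓ a a
  nextMod-irrefl (inj₁ sa≡a)           = 1+n≢n sa≡a
  nextMod-irrefl (inj₂ (sa≡n , refl))  = <-irrefl sa≡n (≤-trans (s≤s (s≤s z≤n)) n≥4)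

  ~⇒layers-differ : ∀ {u v} → u ~ v → lay u ≢ lay v
  ~⇒layers-differ {u} (inj₁ uv) same = nextMod-irrefl (subst (NextMod ℓ (lay u)) (sym same) uv)
  ~⇒layers-differ {u} (inj₂ vu) same = nextMod-irrefl (subst (λ a → NextMod ℓ a (lay u)) (sym same) vu)

  open SymmetricWalks (W m ℓ) (λ {u} {v} → ~-sym {u} {v})

  -- Every step changes the offset to a fixed layer by one, so the cyclic distance
  -- between the layers is a lower bound for the length of any walk.
  walk-bound : ∀ {u z k} → Walk (W m ℓ) u z k → cdist (off (lay u) (lay z)) ≤ k
  walk-bound {u} (here _) = ≤-reflexive (cong cdist (off-self (lay<n u)))
  walk-bound {u} {z} (step {w = w} _ (inj₁ uw) wk) = begin
    cdist (off (lay u) (lay z))                  ≡⟨ cong cdist shift ⟩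
    cdist (suc (off (lay w) (lay z)) % n)        ≤⟨ proj₁ (cdist-next (off<n (lay w) (lay z))) ⟩
    suc (cdist (off (lay w) (lay z)))            ≤⟨ s≤s (walk-bound wk) ⟩
    suc _                                        ∎
    where
    open ≤-Reasoning
    shift : off (lay u) (lay z) ≡ suc (off (lay w) (lay z)) % n
    shift = trans (off-next (lay<n u) (lay<n z)) (cong (λ a → suc (off a (lay z)) % n) (nextMod⇒ (lay<n w) uw))
  walk-bound {u} {z} (step {w = w} _ (inj₂ wu) wk) = begin
    cdist (off (lay u) (lay z))                  ≤⟨ proj₂ (cdist-next (off<n (lay u) (lay z))) ⟩
    suc (cdist (suc (off (lay u) (lay z)) % n))  ≡⟨ cong (suc ∘′ cdist) (sym shift) ⟩
    suc (cdist (off (lay w) (lay z)))            ≤⟨ s≤s (walk-bound wk) ⟩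
    suc _                                        ∎
    where
    open ≤-Reasoning
    shift : off (lay w) (lay z) ≡ suc (off (lay u) (lay z)) % n
    shift = trans (off-next (lay<n w) (lay<n z)) (cong (λ a → suc (off a (lay z)) % n) (nextMod⇒ (lay<n u) wu))

  forward : ∀ k {u z} → off (lay u) (lay z) ≡ suc k → Walk (W m ℓ) u z (suc k)
  forward zero {u} {z} e = step {w = z} (λ ()) (~-forward {u} {z} z-next) (here (λ ()))
    where
    z-next : suc (lay u) % n ≡ lay z
    z-next = off-zero (m%n<n (suc (lay u)) n) (lay<n z) (off-pred (lay<n u) (lay<n z) e)
  forward (suc k) {u} {z} e = step {w = w} (λ ()) (~-forward {u} {w} (sym (lay-vertexAt next<n))) (forward k e′)
    where
    next<n = m%n<n (suc (lay u)) n
    w = vertexAt _ next<n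
    e′ : off (lay w) (lay z) ≡ suc k
    e′ = trans (cong (λ a → off a (lay z)) (lay-vertexAt next<n)) (off-pred (lay<n u) (lay<n z) e)

  walk-of-offset : ∀ {u z} → lay u ≢ lay z → Walk (W m ℓ) u z (off (lay u) (lay z))
  walk-of-offset {u} {z} apart with off (lay u) (lay z) in e
  ... | zero  = contradiction (off-zero (lay<n u) (lay<n z) e) apart
  ... | suc k = forward k e

  dist-refl : ∀ {u} → Dist (W m ℓ) u u 0
  dist-refl = here (λ ()) , λ _ ()

  dist-apart : ∀ {u z} → lay u ≢ lay z → Dist (W m ℓ) u z (cdist (off (lay u) (lay z)))
  dist-apart {u} {z} apart = walk (⊓-sel r (n ∸ r)) , λ k k<d wk → <⇒≱ k<d (walk-bound wk)
    where
    r = off (lay u) (lay z)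
    walk : cdist r ≡ r ⊎ cdist r ≡ n ∸ r → Walk (W m ℓ) u z (cdist r)
    walk (inj₁ e) = subst (Walk (W m ℓ) u z) (sym e) (walk-of-offset apart)
    walk (inj₂ e) = subst (Walk (W m ℓ) u z) (trans (off-flip (lay<n u) (lay<n z) apart) (sym e))
                      (reverse (walk-of-offset (λ e′ → apart (sym e′))))

  dist-adjacent : ∀ {u z} → u ~ z → Dist (W m ℓ) u z 1
  dist-adjacent {u} {z} u~z = step {w = z} (λ ()) u~z (here (λ ())) , shorter
    where
    shorter : ∀ k → k < 1 → ¬ Walk (W m ℓ) u z k
    shorter .0 _ (here _) = ~⇒layers-differ {u} {u} u~z refl
    shorter (suc _) (s≤s ()) _

  dist-layer : ∀ {u z} → lay u ≡ lay z → u ≢ z → Dist (W m ℓ) u z 2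
  dist-layer {u} {z} same u≢z = step {w = w} (λ ()) u~w (step {w = z} (λ ()) w~z (here (λ ()))) , shorter
    where
    next<n = m%n<n (suc (lay u)) n
    w = vertexAt _ next<n
    u~w : u ~ w
    u~w = ~-forward {u} {w} (sym (lay-vertexAt next<n))
    w~z : w ~ z
    w~z = ~-sym {z} {w} (~-layers {u} {w} {z} {w} same refl u~w)
    shorter : ∀ k → k < 2 → ¬ Walk (W m ℓ) u z k
    shorter .0 _ (here _) = u≢z refl
    shorter .1 _ (step _ u~z (here _)) = ~⇒layers-differ {u} {z} u~z same
    shorter (suc (suc _)) (s≤s (s≤s ())) _

  dist : V → V → ℕ
  dist u z with lay u ≟ lay z
  ... | no _ = cdist (off (lay u) (lay z))
  ... | yes _ with u ≟V z
  ...   | yes _ = 0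
  ...   | no _  = 2

  dist-spec : ∀ u z → Dist (W m ℓ) u z (dist u z)
  dist-spec u z with lay u ≟ lay z
  ... | no apart = dist-apart apart
  ... | yes same with u ≟V z
  ...   | yes refl = dist-refl
  ...   | no u≢z   = dist-layer same u≢z

  dist≡ : ∀ {u z d} → Dist (W m ℓ) u z d → dist u z ≡ d
  dist≡ {u} {z} = Dist-unique (W m ℓ) (dist-spec u z)

  Closer : V → V → V → Set
  Closer u v z = dist u z < dist v z

  Closer⇔InW : ∀ u v z → Closer u v z ⇔ InW (W m ℓ) u v z
  Closer⇔InW u v z = mk⇔
    (λ d<d → dist u z , dist v z , dist-spec u z , dist-spec v z , d<d)
    (λ { (a , b , da , db , a<b) → subst₂ _<_ (sym (dist≡ da)) (sym (dist≡ db)) a<b })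

  inLayer : (a : Fin n) → Fin (fW m (toℕ a)) → V
  inLayer a s = a , s

  layer : Fin n → List V
  layer a = map (inLayer a) (allFin (fW m (toℕ a)))

  ∈-layer⁺ : ∀ {z a} → proj₁ z ≡ a → z ∈ layer a
  ∈-layer⁺ {a , s} refl = ∈-map⁺ (inLayer a) (∈-allFin s)

  ∈-layer⁻ : ∀ {z a} → z ∈ layer a → proj₁ z ≡ a
  ∈-layer⁻ {a = a} z∈ with ∈-map⁻ (inLayer a) z∈
  ... | _ , _ , refl = refl

  layer-unique : ∀ a → Unique (layer a)
  layer-unique a = Unique.map⁺ (λ { refl → refl }) (Unique.allFin⁺ _)

  layer-length : ∀ a → length (layer a) ≡ fW m (toℕ a)
  layer-length a = trans (length-map (inLayer a) (allFin (fW m (toℕ a)))) (length-tabulate {n = fW m (toℕ a)} (λ s → s))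

  ring : ℕ → ℕ → Fin n
  ring i r = fromℕ< (m%n<n (i + r) n)

  lay-ring : ∀ {z} i r → proj₁ z ≡ ring i r → lay z ≡ (i + r) % n
  lay-ring i r refl = toℕ-fromℕ< (m%n<n (i + r) n)

  off-ring : ∀ {z i r} → i < n → r < n → proj₁ z ≡ ring i r → off i (lay z) ≡ r
  off-ring {z} {i} {r} i<n r<n z∈ = off-char i<n r<n (sym (lay-ring {z} i r z∈))

  fW-ring : ∀ i r → fW m (toℕ (ring i r)) ≡ fW m (i + r)
  fW-ring i r = trans (cong (fW m) (toℕ-fromℕ< (m%n<n (i + r) n))) (fW-mod m (i + r) n (m∣m*n ℓ))

  sweep : ℕ → ℕ → List V
  sweep i zero    = []
  sweep i (suc r) = sweep i r ++ layer (ring i r)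

  ∈-sweep⁻ : ∀ {i r z} → i < n → r ≤ n → z ∈ sweep i r → off i (lay z) < r
  ∈-sweep⁻ {i} {suc r} {z} i<n r≤n z∈ with ∈-++⁻ (sweep i r) z∈
  ... | inj₁ z∈sweep = m<n⇒m<1+n (∈-sweep⁻ {i} {r} {z} i<n (<⇒≤ r≤n) z∈sweep)
  ... | inj₂ z∈layer = ≤-reflexive (cong suc (off-ring {z} {i} {r} i<n r≤n (∈-layer⁻ z∈layer)))

  ∈-sweep⁺ : ∀ {i r z} → i < n → off i (lay z) < r → z ∈ sweep i r
  ∈-sweep⁺ {i} {suc r} {z} i<n off<r with m≤n⇒m<n∨m≡n (≤-pred off<r)
  ... | inj₁ off<r′ = ∈-++⁺ˡ (∈-sweep⁺ i<n off<r′)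
  ... | inj₂ refl   = ∈-++⁺ʳ (sweep i r) (∈-layer⁺ (toℕ-injective (trans (off-spec′) (sym (toℕ-fromℕ< _)))))
    where
    off-spec′ : lay z ≡ (i + off i (lay z)) % n
    off-spec′ = sym (off-spec i<n (lay<n z))

  sweep-unique : ∀ {i} r → i < n → r ≤ n → Unique (sweep i r)
  sweep-unique zero    i<n r≤n = []
  sweep-unique {i} (suc r) i<n r≤n = Unique.++⁺ (sweep-unique r i<n (<⇒≤ r≤n)) (layer-unique (ring i r))
    λ {z} (z∈sweep , z∈layer) →
      <-irrefl (off-ring {z} {i} {r} i<n r≤n (∈-layer⁻ z∈layer)) (∈-sweep⁻ {i} {r} {z} i<n (<⇒≤ r≤n) z∈sweep)

  module Counting {P : V → Set} (P? : Decidable P) where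

    count : Fin n → ℕ
    count a = length (filter P? (layer a))

    count-sweep : ∀ i r → length (filter P? (sweep i r)) ≡ sum< r (λ j → count (ring i j))
    count-sweep i zero    = refl
    count-sweep i (suc r) = trans (cong length (filter-++ P? (sweep i r) (layer (ring i r))))
      (trans (length-++ (filter P? (sweep i r))) (cong (_+ count (ring i r)) (count-sweep i r)))

    size-by-layers : ∀ {i} → i < n → HasSize (W m ℓ) P (sum< n (λ r → count (ring i r)))
    size-by-layers {i} i<n =
      filter P? (sweep i n) , Unique.filter⁺ P? (sweep-unique n i<n ≤-refl) ,
      (λ z → mk⇔ (λ z∈ → proj₂ (∈-filter⁻ P? {xs = sweep i n} z∈))
                 (∈-filter⁺ P? (∈-sweep⁺ {i} {n} {z} i<n (off<n i (lay z))))) ,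
      count-sweep i n

    count-all : ∀ a → (∀ z → proj₁ z ≡ a → P z) → count a ≡ fW m (toℕ a)
    count-all a all = trans (cong length (filter-all P? (All.tabulate (λ z∈ → all _ (∈-layer⁻ z∈))))) (layer-length a)

    count-none : ∀ a → (∀ z → proj₁ z ≡ a → ¬ P z) → count a ≡ 0
    count-none a none = cong length (filter-none P? (All.tabulate (λ z∈ → none _ (∈-layer⁻ z∈))))

  -- For an edge a ~ b and a vertex z in the layer of a: z is closer to a than to b
  -- exactly when z = a (distance 0 against 1), and otherwise closer to b (1 against 2).
  same-layer-split : ∀ {a b z} → a ~ b → proj₁ z ≡ proj₁ a → (Closer a b z ⇔ z ≡ a) × (Closer b a z ⇔ z ≢ a)
  same-layer-split {a} {b} {z} a~b z∈ with z ≟V a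
  ... | yes refl = ⇔-both (subst₂ _<_ (sym (dist≡ (dist-refl {a}))) (sym d-b) (s≤s z≤n)) refl
                 , ⇔-neither (λ b<a → contradiction (subst₂ _<_ d-b (dist≡ (dist-refl {a})) b<a) λ ())
                             (λ a≢a → a≢a refl)
    where
    d-b : dist b a ≡ 1
    d-b = dist≡ (dist-adjacent {b} {a} (~-sym {a} {b} a~b))
  ... | no z≢a = ⇔-neither (λ a<b → contradiction (subst₂ _<_ d-a d-b a<b) λ { (s≤s ()) }) z≢a
               , ⇔-both (subst₂ _<_ (sym d-b) (sym d-a) (s≤s (s≤s z≤n))) z≢a
    where
    same : lay a ≡ lay z
    same = cong toℕ (sym z∈)
    d-a : dist a z ≡ 2
    d-a = dist≡ (dist-layer same (λ a≡z → z≢a (sym a≡z)))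
    d-b : dist b z ≡ 1
    d-b = dist≡ (dist-adjacent {b} {z} (~-sym {z} {b} (~-layers {a} {b} {z} {b} same refl a~b)))

  dist-off : ∀ {a z k} → off (lay a) (lay z) ≡ k → 0 < k → dist a z ≡ cdist k
  dist-off {a} {z} e 0<k = trans (dist≡ (dist-apart apart)) (cong cdist e)
    where
    apart : lay a ≢ lay z
    apart same = <-irrefl (trans (sym (off-self (lay<n a))) (trans (cong (off (lay a)) same) e)) 0<k

  -- Half the cycle, and the number t of layers strictly between the two ends of an
  -- edge and the antipodal layer: n = 2 + t + t.
  h : ℕ
  h = 2 * ℓ

  h≥2 : 2 ≤ h
  h≥2 = *-monoʳ-≤ 2 ℓ≥1

  t : ℕ
  t = pred h

  h≡1+t : h ≡ suc t
  h≡1+t = sym (suc-pred h {{>-nonZero (≤-trans (s≤s z≤n) h≥2)}})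

  n≡h+h : n ≡ h + h
  n≡h+h = *-distribʳ-+ ℓ 2 2

  h<n : h < n
  h<n = subst (h <_) (sym n≡h+h) (m<m+n h (≤-trans (s≤s z≤n) h≥2))

  within-half : ∀ {r} → r ≤ h → r + r ≤ n
  within-half {r} r≤h = subst (r + r ≤_) (sym n≡h+h) (+-mono-≤ r≤h r≤h)

  beyond-half : ∀ {r} → h ≤ r → n ≤ r + r
  beyond-half {r} h≤r = subst (_≤ r + r) (sym n≡h+h) (+-mono-≤ h≤r h≤r)

  n≡2+t+t : n ≡ 2 + t + t
  n≡2+t+t = trans n≡h+h (trans (cong₂ _+_ h≡1+t h≡1+t) (cong suc (+-suc t t)))

  module Edge (u v : V) (uv : suc (lay u) % n ≡ lay v) where

    i : ℕ
    i = lay u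

    u~v : u ~ v
    u~v = ~-forward {u} {v} uv

    offsets : ∀ {z r} → suc r < n → proj₁ z ≡ ring i (suc r) →
              off (lay u) (lay z) ≡ suc r × off (lay v) (lay z) ≡ r
    offsets {z} {r} sr<n z∈ = off-u , subst (λ a → off a (lay z) ≡ r) uv (off-pred (lay<n u) (lay<n z) off-u)
      where
      off-u = off-ring {z} {i} {suc r} (lay<n u) sr<n z∈

    near : ∀ {z r} → 1 ≤ r → suc r ≤ h → proj₁ z ≡ ring i (suc r) → Closer v u z
    near {z} {suc r} _ sr≤h z∈ = subst₂ _<_ (sym d-v) (sym d-u) ≤-refl
      where
      offs = offsets {z} {suc r} (≤-<-trans sr≤h h<n) z∈
      d-u : dist u z ≡ suc (suc r)
      d-u = trans (dist-off {u} (proj₁ offs) (s≤s z≤n)) (cdist-small (within-half sr≤h))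
      d-v : dist v z ≡ suc r
      d-v = trans (dist-off {v} (proj₂ offs) (s≤s z≤n)) (cdist-small (within-half (≤-trans (n≤1+n _) sr≤h)))

    far : ∀ {z r} → h ≤ r → suc r < n → proj₁ z ≡ ring i (suc r) → Closer u v z
    far {z} {r} h≤r sr<n z∈ = subst₂ _<_ (sym d-u) (sym d-v) (≤-reflexive (sym (+-∸-assoc 1 (<⇒≤ sr<n))))
      where
      offs = offsets {z} {r} sr<n z∈
      d-u : dist u z ≡ n ∸ suc r
      d-u = trans (dist-off {u} (proj₁ offs) (s≤s z≤n)) (cdist-large (beyond-half (≤-trans h≤r (n≤1+n r))))
      d-v : dist v z ≡ n ∸ r
      d-v = trans (dist-off {v} (proj₂ offs) (<-≤-trans (≤-trans (s≤s z≤n) h≥2) h≤r)) (cdist-large (beyond-half h≤r))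

    ring-0 : ring i 0 ≡ proj₁ u
    ring-0 = toℕ-injective (trans (toℕ-fromℕ< (m%n<n (i + 0) n))
                              (trans (cong (_% n) (+-identityʳ i)) (m<n⇒m%n≡m (lay<n u))))

    ring-1 : ring i 1 ≡ proj₁ v
    ring-1 = toℕ-injective (trans (toℕ-fromℕ< (m%n<n (i + 1) n)) (trans (cong (_% n) (+-comm i 1)) uv))

    fW-v : fW m (toℕ (ring i 1)) ≡ fW m (suc i)
    fW-v = trans (fW-ring i 1) (cong (fW m) (+-comm i 1))

    module UV = Counting (λ z → dist u z <? dist v z)
    module VU = Counting (λ z → dist v z <? dist u z)

    around : ∀ (c : ℕ → ℕ) → sum< n c ≡ c 0 + c 1 + sum< t (λ j → c (2 + j)) + sum< t (λ j → c (2 + t + j))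
    around c = trans (cong (λ k → sum< k c) n≡2+t+t)
                 (trans (sum<-split (2 + t) t c) (cong (_+ sum< t (λ j → c (2 + t + j))) (sum<-split 2 t c)))

    near-at : ∀ {z j} → j < t → proj₁ z ≡ ring i (2 + j) → Closer v u z
    near-at {z} {j} j<t z∈ = near {z} {suc j} (s≤s z≤n) (subst (2 + j ≤_) (sym h≡1+t) (s≤s j<t)) z∈

    far-at : ∀ {z j} → j < t → proj₁ z ≡ ring i (2 + t + j) → Closer u v z
    far-at {z} {j} j<t z∈ = far {z} {suc t + j} (subst (_≤ suc t + j) (sym h≡1+t) (m≤m+n (suc t) j))
                              (subst (2 + t + j <_) (sym n≡2+t+t) (+-monoʳ-< (2 + t) j<t)) z∈

    own-u : UV.count (ring i 0) ≡ 1
    own-u = count-only _ (layer (ring i 0)) (layer-unique _) (∈-layer⁺ (sym ring-0))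
              (λ z z∈ → proj₁ (same-layer-split {u} {v} u~v (trans (∈-layer⁻ z∈) ring-0)))

    rest-u : suc (VU.count (ring i 0)) ≡ fW m i
    rest-u = trans (count-allBut _ (layer (ring i 0)) (layer-unique _) (∈-layer⁺ (sym ring-0))
                      (λ z z∈ → proj₂ (same-layer-split {u} {v} u~v (trans (∈-layer⁻ z∈) ring-0))))
                   (trans (layer-length (ring i 0)) (cong (λ a → fW m (toℕ a)) ring-0))

    own-v : VU.count (ring i 1) ≡ 1
    own-v = count-only _ (layer (ring i 1)) (layer-unique _) (∈-layer⁺ (sym ring-1))
              (λ z z∈ → proj₁ (same-layer-split {v} {u} (~-sym {u} {v} u~v) (trans (∈-layer⁻ z∈) ring-1)))

    rest-v : suc (UV.count (ring i 1)) ≡ fW m (suc i)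
    rest-v = trans (count-allBut _ (layer (ring i 1)) (layer-unique _) (∈-layer⁺ (sym ring-1))
                      (λ z z∈ → proj₂ (same-layer-split {v} {u} (~-sym {u} {v} u~v) (trans (∈-layer⁻ z∈) ring-1))))
                   (trans (layer-length (ring i 1)) fW-v)

    size-uv : HasSize (W m ℓ) (InW (W m ℓ) u v) (sideU m i t)
    size-uv = HasSize-⇔ (W m ℓ) (λ z → Closer⇔InW u v z)
                (subst (HasSize (W m ℓ) (Closer u v)) total (UV.size-by-layers (lay<n u)))
      where
      open ≡-Reasoning
      c = λ r → UV.count (ring i r)
      beyond : ∀ j → j < t → c (2 + t + j) ≡ fW m (i + (2 + t) + j)
      beyond j j<t = trans (UV.count-all _ (λ z z∈ → far-at j<t z∈))
                       (trans (fW-ring i (2 + t + j)) (cong (fW m) (sym (+-assoc i (2 + t) j))))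
      total : sum< n c ≡ sideU m i t
      total = begin
        sum< n c
          ≡⟨ around c ⟩
        c 0 + c 1 + sum< t (λ j → c (2 + j)) + sum< t (λ j → c (2 + t + j))
          ≡⟨ cong₂ _+_ (cong₂ _+_ (trans (cong (_+ c 1) own-u) rest-v)
                                  (sum<-zero t (λ j j<t → UV.count-none _ (λ z z∈ closer → <-asym closer (near-at j<t z∈)))))
                       (sum<-cong t beyond) ⟩
        fW m (suc i) + 0 + block m (i + (2 + t)) t
          ≡⟨ cong (_+ block m (i + (2 + t)) t) (+-identityʳ _) ⟩
        fW m (suc i) + block m (i + (2 + t)) t
          ∎

    size-vu : HasSize (W m ℓ) (InW (W m ℓ) v u) (sideV m i t)
    size-vu = HasSize-⇔ (W m ℓ) (λ z → Closer⇔InW v u z)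
                (subst (HasSize (W m ℓ) (Closer v u)) total (VU.size-by-layers (lay<n u)))
      where
      open ≡-Reasoning
      c = λ r → VU.count (ring i r)
      before : ∀ j → j < t → c (2 + j) ≡ fW m (i + 2 + j)
      before j j<t = trans (VU.count-all _ (λ z z∈ → near-at j<t z∈))
                       (trans (fW-ring i (2 + j)) (cong (fW m) (sym (+-assoc i 2 j))))
      total : sum< n c ≡ sideV m i t
      total = begin
        sum< n c
          ≡⟨ around c ⟩
        c 0 + c 1 + sum< t (λ j → c (2 + j)) + sum< t (λ j → c (2 + t + j))
          ≡⟨ cong₂ _+_ (cong₂ _+_ (trans (cong (c 0 +_) own-v) (trans (+-comm (c 0) 1) rest-u)) (sum<-cong t before))
                       (sum<-zero t (λ j j<t → VU.count-none _ (λ z z∈ closer → <-asym closer (far-at j<t z∈)))) ⟩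
        fW m i + block m (i + 2) t + 0
          ≡⟨ +-identityʳ _ ⟩
        fW m i + block m (i + 2) t
          ∎

-- The two one-vertex layers 0 and 3 separate the layers 1 and 2 from the rest of the graph.
module Cut (m ℓ : ℕ) (m≥1 : 1 ≤ m) (ℓ≥2 : 2 ≤ ℓ) where
  open Layered m ℓ m≥1 (≤-trans (s≤s z≤n) ℓ≥2)

  n≥8 : 8 ≤ n
  n≥8 = *-monoʳ-≤ 4 ℓ≥2

  0<n : 0 < n
  0<n = ≤-trans (s≤s z≤n) n≥8

  3<n : 3 < n
  3<n = ≤-trans (s≤s (s≤s (s≤s (s≤s z≤n)))) n≥8

  separator : List V
  separator = vertexAt 0 0<n ∷ vertexAt 3 3<n ∷ []

  vertex-≡ : ∀ {u z} → lay u ≡ lay z → toℕ (proj₂ u) ≡ toℕ (proj₂ z) → u ≡ z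
  vertex-≡ {a , s} {b , s′} e₁ e₂ with toℕ-injective {i = a} {j = b} e₁
  ... | refl with toℕ-injective {i = s} {j = s′} e₂
  ...   | refl = refl

  thin-layer : ∀ {k w} (k<n : k < n) → fW m k ≡ 1 → lay w ≡ k → w ≡ vertexAt k k<n
  thin-layer {k} {w} k<n size-1 w∈ =
    vertex-≡ (trans w∈ (sym (lay-vertexAt k<n)))
             (trans (only-index w (trans (cong (fW m) w∈) size-1))
                    (sym (only-index (vertexAt k k<n) (trans (cong (fW m) (lay-vertexAt k<n)) size-1))))
    where
    only-index : ∀ x → fW m (lay x) ≡ 1 → toℕ (proj₂ x) ≡ 0
    only-index x size = n<1⇒n≡0 (subst (toℕ (proj₂ x) <_) size (toℕ<n (proj₂ x)))

  ∈-separator : ∀ {w} → lay w ≡ 0 ⊎ lay w ≡ 3 → w ∈ separator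
  ∈-separator (inj₁ w∈0) = here (thin-layer 0<n refl w∈0)
  ∈-separator (inj₂ w∈3) = there (here (thin-layer 3<n refl w∈3))

  ∉-separator : ∀ {w} → lay w ≢ 0 → lay w ≢ 3 → w ∉ separator
  ∉-separator ≢0 ≢3 (here refl)         = ≢0 (lay-vertexAt 0<n)
  ∉-separator ≢0 ≢3 (there (here refl)) = ≢3 (lay-vertexAt 3<n)

  Inner : ℕ → Set
  Inner a = a ≡ 1 ⊎ a ≡ 2

  inner-step : ∀ {x w} → Inner (lay x) → x ~ w → w ∉ separator → Inner (lay w)
  inner-step (inj₁ x≡1) (inj₁ (inj₁ sx≡w)) _ = inj₂ (trans (sym sx≡w) (cong suc x≡1))
  inner-step (inj₂ x≡2) (inj₁ (inj₁ sx≡w)) w∉ =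
    contradiction (∈-separator (inj₂ (trans (sym sx≡w) (cong suc x≡2)))) w∉
  inner-step {x} x∈ (inj₁ (inj₂ (sx≡n , _))) _ =
    contradiction (subst (_≤ 3) sx≡n (s≤s (≤-inner x∈))) (<⇒≱ (≤-trans (s≤s (s≤s (s≤s (s≤s z≤n)))) n≥8))
    where
    ≤-inner : ∀ {a} → Inner a → a ≤ 2
    ≤-inner (inj₁ refl) = s≤s z≤n
    ≤-inner (inj₂ refl) = ≤-refl
  inner-step (inj₁ x≡1) (inj₂ (inj₁ sw≡x)) w∉ =
    contradiction (∈-separator (inj₁ (suc-injective (trans sw≡x x≡1)))) w∉
  inner-step (inj₂ x≡2) (inj₂ (inj₁ sw≡x)) _ = inj₁ (suc-injective (trans sw≡x x≡2))
  inner-step (inj₁ x≡1) (inj₂ (inj₂ (_ , x≡0))) _ = contradiction (trans (sym x≡1) x≡0) λ ()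
  inner-step (inj₂ x≡2) (inj₂ (inj₂ (_ , x≡0))) _ = contradiction (trans (sym x≡2) x≡0) λ ()

  start-avoids : ∀ {x y k} → WalkAvoid (W m ℓ) separator x y k → x ∉ separator
  start-avoids (here x∉)     = x∉
  start-avoids (step x∉ _ _) = x∉

  inner-walk : ∀ {x y k} → WalkAvoid (W m ℓ) separator x y k → Inner (lay x) → Inner (lay y)
  inner-walk (here _) x∈ = x∈
  inner-walk {x} (step {w = w} _ x~w wk) x∈ = inner-walk wk (inner-step {x} {w} x∈ x~w (start-avoids wk))

  1<n : 1 < n
  1<n = ≤-trans (s≤s (s≤s z≤n)) n≥8

  4<n : 4 < n
  4<n = ≤-trans (s≤s (s≤s (s≤s (s≤s (s≤s z≤n))))) n≥8

  outside : ∀ {a} (a<n : a < n) → a ≢ 0 → a ≢ 3 → vertexAt a a<n ∉ separator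
  outside a<n ≢0 ≢3 =
    ∉-separator (λ e → ≢0 (trans (sym (lay-vertexAt a<n)) e)) (λ e → ≢3 (trans (sym (lay-vertexAt a<n)) e))

  not-3-connected : ¬ ThreeConnected (W m ℓ)
  not-3-connected (_ , connected) =
    let (_ , walk) = connected separator (s≤s (s≤s z≤n)) (vertexAt 1 1<n) (vertexAt 4 4<n)
                       (outside 1<n (λ ()) (λ ())) (outside 4<n (λ ()) (λ ()))
    in layer-4-outer (inner-walk walk (inj₁ (lay-vertexAt 1<n)))
    where
    layer-4-outer : ¬ Inner (lay (vertexAt 4 4<n))
    layer-4-outer (inj₁ e) = contradiction (trans (sym (lay-vertexAt 4<n)) e) λ ()
    layer-4-outer (inj₂ e) = contradiction (trans (sym (lay-vertexAt 4<n)) e) λ ()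

-- Distance-balance of W(m,ℓ) is decided by the residue of t = 2ℓ - 1 modulo 4.
module Balance (m ℓ : ℕ) (m≥1 : 1 ≤ m) (ℓ≥1 : 1 ≤ ℓ) where
  open Layered m ℓ m≥1 ℓ≥1

  W-connected : Connected (W m ℓ)
  W-connected u v = dist u v , proj₁ (dist-spec u v)

  balanced-if : (∀ i → sideU m i t ≡ sideV m i t) → DistanceBalanced (W m ℓ)
  balanced-if agree = W-connected , balanced
    where
    Balanced : V → V → Set
    Balanced u v = ∃ λ N → HasSize (W m ℓ) (InW (W m ℓ) u v) N × HasSize (W m ℓ) (InW (W m ℓ) v u) N
    forward-edge : ∀ u v → suc (lay u) % n ≡ lay v → Balanced u v
    forward-edge u v uv = _ , Edge.size-uv u v uv
                            , subst (HasSize (W m ℓ) (InW (W m ℓ) v u)) (sym (agree (lay u))) (Edge.size-vu u v uv)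
    balanced : ∀ u v → u ~ v → Balanced u v
    balanced u v (inj₁ uv) = forward-edge u v (nextMod⇒ (lay<n v) uv)
    balanced u v (inj₂ vu) = let (N , A , B) = forward-edge v u (nextMod⇒ (lay<n u) vu) in N , B , A

  t-from : ∀ {x} → 2 * ℓ ≡ suc x → t ≡ x
  t-from e = suc-injective (trans (sym h≡1+t) e)

  -- ℓ = 2k + 1 gives t = 4k + 1.
  odd⇒balanced : ℓ % 2 ≡ 1 → DistanceBalanced (W m ℓ)
  odd⇒balanced odd =
    balanced-if (subst (λ s → ∀ i → sideU m i s ≡ sideV m i s) (sym t≡4k+1) (λ i → balanced-odd m i k))
    where
    k = ℓ / 2
    double : ∀ k → 2 * (1 + k * 2) ≡ suc (k * 4 + 1)
    double = solve-∀
    t≡4k+1 : t ≡ k * 4 + 1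
    t≡4k+1 = t-from (trans (cong (2 *_) (trans (m≡m%n+[m/n]*n ℓ 2) (cong (_+ k * 2) odd))) (double k))

  -- ℓ = 2k + 2 gives t = 4k + 3, and the edge from layer 0 to layer 1 is unbalanced.
  even⇒unbalanced : 2 ≤ m → ℓ % 2 ≡ 0 → ¬ DistanceBalanced (W m ℓ)
  even⇒unbalanced m≥2 even = unbalanced-at (ℓ / 2) (trans (m≡m%n+[m/n]*n ℓ 2) (cong (_+ (ℓ / 2) * 2) even))
    where
    0<n = ≤-trans (s≤s z≤n) n≥4
    1<n = ≤-trans (s≤s (s≤s z≤n)) n≥4
    u₀ = vertexAt 0 0<n
    v₀ = vertexAt 1 1<n
    u₀v₀ : suc (lay u₀) % n ≡ lay v₀
    u₀v₀ = trans (cong (λ a → suc a % n) (lay-vertexAt 0<n)) (trans (m<n⇒m%n≡m 1<n) (sym (lay-vertexAt 1<n)))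
    double : ∀ k → 2 * (suc k * 2) ≡ suc (k * 4 + 3)
    double = solve-∀
    unbalanced-at : ∀ q → ℓ ≡ q * 2 → ¬ DistanceBalanced (W m ℓ)
    unbalanced-at zero    ℓ≡0 _ = contradiction (subst (1 ≤_) ℓ≡0 ℓ≥1) λ ()
    unbalanced-at (suc k) ℓ≡q2 (_ , balanced) =
      let (_ , A , B) = balanced u₀ v₀ (~-forward {u₀} {v₀} u₀v₀)
          same = trans (sym (HasSize-unique (W m ℓ) A (Edge.size-uv u₀ v₀ u₀v₀)))
                       (HasSize-unique (W m ℓ) B (Edge.size-vu u₀ v₀ u₀v₀))
      in unbalanced-even m k m≥2
           (subst₂ (λ i s → sideU m i s ≡ sideV m i s)
                   (lay-vertexAt 0<n) (t-from (trans (cong (2 *_) ℓ≡q2) (double k))) same)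

  balanced⇒odd : 2 ≤ m → DistanceBalanced (W m ℓ) → ℓ % 2 ≡ 1
  balanced⇒odd m≥2 balanced with ℓ % 2 in parity | m%n<n ℓ 2
  ... | 0           | _               = contradiction balanced (even⇒unbalanced m≥2 parity)
  ... | 1           | _               = refl
  ... | suc (suc _) | s≤s (s≤s ())

theorem3p6 : (m ℓ : ℕ) → 2 ≤ m → 3 ≤ ℓ →
    Bipartite (W m ℓ) × ¬ ThreeConnected (W m ℓ) × (DistanceBalanced (W m ℓ) ⇔ ℓ % 2 ≡ 1)
theorem3p6 m ℓ m≥2 ℓ≥3 =
  W-bipartite m ℓ ,
  Cut.not-3-connected m ℓ m≥1 (≤-trans (s≤s (s≤s z≤n)) ℓ≥3) ,
  mk⇔ (Balance.balanced⇒odd m ℓ m≥1 ℓ≥1 m≥2) (Balance.odd⇒balanced m ℓ m≥1 ℓ≥1)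
  where
  m≥1 = ≤-trans (s≤s z≤n) m≥2
  ℓ≥1 = ≤-trans (s≤s z≤n) ℓ≥3
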